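{- Let $G=(V,E,C)$ be a $C$-colored graph with no edge $\{u,v\}$ with $c(u)=c(v)$, let $k$ be a positive integer, and let $D'$ be the rooted spanning tree of (the connected graph) $G$ produced by a depth-first search. If $D'$ contains a path from its root to a leaf of length at least $2k$, then MEC on $G$ has a solution whose transitive closure has at least $k$ edges.
   Context: A $C$-colored graph assigns to each vertex $v$ a color $c(v)\in C$. A connected component is colorful if no two of its vertices share a color. If a graph has connected components with $n_1,\dots,n_t$ vertices, the number of edges in its transitive closure is $\sum_i n_i(n_i-1)/2$. MEC: given $G=(V,E,C)$, a solution is a set $E'\subseteq E$ such that every connected component of $(V,E\setminus E',C)$ is colorful; its value (to be maximized) is the number of edges in the transitive closure of $(V,E\setminus E')$. The paper assumes throughout that no edge joins two vertices of the same color. -}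

module Defs where

open import Data.Nat using (ℕ; zero; suc; _+_; _*_; _≤_; _<_)
open import Data.Fin using (Fin; toℕ)
open import Data.Product using (_×_; _,_; Σ; proj₁; proj₂)
open import Data.Sum using (_⊎_)
open import Data.List using (List)
open import Data.List.Membership.Propositional using (_∈_)
open import Relation.Binary.PropositionalEquality using (_≡_; _≢_)
open import Relation.Binary.Construct.Closure.ReflexiveTransitive using (Star)
open import Relation.Nullary using (¬_)
open import Function.Definitions using (Injective)

-- A graph on vertex set V = Fin n; edges are unordered, given as a list of
-- pairs, where the pair (u , v) stands for the edge {u , v}.
Edges : ℕ → Set
Edges n = List (Fin n × Fin n)

EdgeIn : ∀ {n} → Edges n → Fin n → Fin n → Set
EdgeIn L u v = ((u , v) ∈ L) ⊎ ((v , u) ∈ L)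

SubEdges : ∀ {n} → Edges n → Edges n → Set
SubEdges {n} E' E = (u v : Fin n) → EdgeIn E' u v → EdgeIn E u v

AdjMinus : ∀ {n} → Edges n → Edges n → Fin n → Fin n → Set
AdjMinus E E' u v = EdgeIn E u v × ¬ EdgeIn E' u v

ConnMinus : ∀ {n} → Edges n → Edges n → Fin n → Fin n → Set
ConnMinus E E' = Star (AdjMinus E E')

AllColorful : ∀ {n} {C : Set} → (Fin n → C) → Edges n → Edges n → Set
AllColorful {n} c E E' = (u v : Fin n) → ConnMinus E E' u v → c u ≡ c v → u ≡ v

MECSolution : ∀ {n} {C : Set} → (Fin n → C) → Edges n → Edges n → Set
MECSolution c E E' = SubEdges E' E × AllColorful c E E'

-- The edges of the transitive closure of (V , E ∖ E') are the unordered pairs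
-- {u , v}, u ≠ v, of vertices in the same component; we represent {u , v}
-- by the ordered pair with toℕ u < toℕ v.
ClosureEdge : ∀ {n} → Edges n → Edges n → Fin n × Fin n → Set
ClosureEdge E E' (u , v) = (toℕ u < toℕ v) × ConnMinus E E' u v

ClosureAtLeast : ∀ {n} → Edges n → Edges n → ℕ → Set
ClosureAtLeast {n} E E' k =
  Σ (Fin k → Fin n × Fin n) λ f → Injective _≡_ _≡_ f × ((i : Fin k) → ClosureEdge E E' (f i))

ProperlyColored : ∀ {n} {C : Set} → (Fin n → C) → Edges n → Set
ProperlyColored {n} c E = (u v : Fin n) → EdgeIn E u v → c u ≢ c v

-- A rooted spanning tree of G with root r is given by a parent function and
-- a depth function: every non-root vertex v is joined in G to its parent,
-- whose depth is one less. (The value of parent r is irrelevant.)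
record RootedSpanningTree {n : ℕ} (E : Edges n) : Set where
  field
    root   : Fin n
    parent : Fin n → Fin n
    depth  : Fin n → ℕ
    depth-root   : depth root ≡ 0
    parent-edge  : (v : Fin n) → v ≢ root → EdgeIn E v (parent v)
    parent-depth : (v : Fin n) → v ≢ root → suc (depth (parent v)) ≡ depth v

  ChildOf : Fin n → Fin n → Set
  ChildOf v p = (v ≢ root) × (parent v ≡ p)

  AncestorOf : Fin n → Fin n → Set
  AncestorOf a d = Star ChildOf d a

  Leaf : Fin n → Set
  Leaf ℓ = (w : Fin n) → ¬ ChildOf w ℓ

  -- the root-to-v path in the tree has length depth v
open RootedSpanningTree public

-- D is a depth-first-search tree of G: a rooted spanning tree in which every
-- edge of G joins an ancestor and a descendant (Trémaux / normal tree
-- property; these are exactly the trees that DFS can produce).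
IsDFSTree : ∀ {n} (E : Edges n) → RootedSpanningTree E → Set
IsDFSTree {n} E D =
  (u v : Fin n) → EdgeIn E u v → AncestorOf D u v ⊎ AncestorOf D v u

-- Along a root-to-leaf path of length at least 2k, the tree edges joining the
-- vertices at distances 2i and 2i + 1 from the leaf (i < k) form a matching of
-- size k. Delete every edge of G outside this matching: the components left are
-- the k matched pairs and singletons. They are colorful because no edge of G is
-- monochromatic, and each pair contributes one edge to the transitive closure.
module Submission where

open import Defs
open import Data.Bool using (Bool; false; true; not)
open import Data.Bool.Properties using (not-involutive)
open import Data.Nat using (ℕ; zero; suc; _+_; _*_; _≤_; _<_; z≤n; s≤s)
open import Data.Nat.DivMod using (_%_; [m+kn]%n≡m%n)
open import Data.Nat.Properties
  using (+-identityʳ; +-suc; +-cancelˡ-≡; +-monoˡ-≤; *-comm; *-monoˡ-≤; *-cancelʳ-≡;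
         ≤-trans; <-≤-trans; <⇒≤; <-irrefl; <-cmp; m<n⇒n≢0)
open import Data.Fin using (Fin; toℕ)
open import Data.Fin.Properties using (_≟_; any?; toℕ-injective; toℕ<n)
open import Data.Product using (Σ; _×_; _,_; proj₁; proj₂; uncurry)
open import Data.Sum using (_⊎_; inj₁; inj₂; swap; [_,_])
import Data.Sum as Sum
open import Data.Empty using (⊥-elim)
open import Data.List using (filter)
open import Data.List.Membership.Propositional using (_∈_)
open import Data.List.Membership.Propositional.Properties using (∈-filter⁺; ∈-filter⁻)
open import Function using (_∘_)
open import Relation.Nullary using (¬_; Dec; yes; no)
open import Relation.Nullary.Decidable using (_×-dec_; _⊎-dec_; ¬?; map′)
open import Relation.Binary using (tri<; tri≈; tri>)
open import Relation.Binary.PropositionalEquality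
  using (_≡_; _≢_; refl; sym; trans; cong; subst; module ≡-Reasoning)
open import Relation.Binary.Construct.Closure.ReflexiveTransitive using (ε; _◅_)

open ≡-Reasoning

Σ-Bool? : {P : Bool → Set} → ((b : Bool) → Dec (P b)) → Dec (Σ Bool P)
Σ-Bool? P? = map′ [ (false ,_) , (true ,_) ] from (P? false ⊎-dec P? true)
  where
  from : ∀ {P} → Σ Bool P → P false ⊎ P true
  from (false , p) = inj₁ p
  from (true  , p) = inj₂ p

bit : Bool → ℕ
bit false = 0
bit true  = 1

bit≤1 : ∀ b → bit b ≤ 1
bit≤1 false = z≤n
bit≤1 true  = s≤s z≤n

bit+*2-injective : ∀ b c m n → bit b + m * 2 ≡ bit c + n * 2 → b ≡ c × m ≡ n
bit+*2-injective b c m n eq = b≡c , *-cancelʳ-≡ m n 2 (+-cancelˡ-≡ (bit b) _ _ eq′)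
  where
  parity : bit b % 2 ≡ bit c % 2
  parity = begin
    bit b % 2           ≡⟨ [m+kn]%n≡m%n (bit b) m 2 ⟨
    (bit b + m * 2) % 2 ≡⟨ cong (_% 2) eq ⟩
    (bit c + n * 2) % 2 ≡⟨ [m+kn]%n≡m%n (bit c) n 2 ⟩
    bit c % 2           ∎
  parity-injective : ∀ b c → bit b % 2 ≡ bit c % 2 → b ≡ c
  parity-injective false false _ = refl
  parity-injective true  true  _ = refl
  parity-injective false true  ()
  parity-injective true  false ()
  b≡c : b ≡ c
  b≡c = parity-injective b c parity
  eq′ : bit b + m * 2 ≡ bit b + n * 2
  eq′ = subst (λ x → bit b + m * 2 ≡ bit x + n * 2) (sym b≡c) eq

module _ {n} {E : Edges n} (D : RootedSpanningTree E) where

  ancestor : ℕ → Fin n → Fin n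
  ancestor zero    v = v
  ancestor (suc j) v = parent D (ancestor j v)

  positive-depth⇒non-root : ∀ {v} → 0 < depth D v → v ≢ root D
  positive-depth⇒non-root 0<d refl = m<n⇒n≢0 0<d (depth-root D)

  depth-ancestor : ∀ j v → j ≤ depth D v → depth D (ancestor j v) + j ≡ depth D v
  ancestor-non-root : ∀ j v → j < depth D v → ancestor j v ≢ root D

  depth-ancestor zero    v _   = +-identityʳ (depth D v)
  depth-ancestor (suc j) v j<d = begin
    depth D (parent D a) + suc j  ≡⟨ +-suc (depth D (parent D a)) j ⟩
    suc (depth D (parent D a)) + j ≡⟨ cong (_+ j) (parent-depth D a (ancestor-non-root j v j<d)) ⟩
    depth D a + j                  ≡⟨ depth-ancestor j v (<⇒≤ j<d) ⟩
    depth D v                      ∎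
    where a = ancestor j v

  ancestor-non-root j v j<d = positive-depth⇒non-root positive
    where
    positive : 0 < depth D (ancestor j v)
    positive with depth D (ancestor j v) | depth-ancestor j v (<⇒≤ j<d)
    ... | zero  | j≡d = ⊥-elim (<-irrefl j≡d j<d)
    ... | suc _ | _   = s≤s z≤n

  ancestor-injective : ∀ {i j v} → i ≤ depth D v → j ≤ depth D v →
                       ancestor i v ≡ ancestor j v → i ≡ j
  ancestor-injective {i} {j} {v} i≤d j≤d eq = +-cancelˡ-≡ (depth D (ancestor i v)) i j (begin
    depth D (ancestor i v) + i ≡⟨ depth-ancestor i v i≤d ⟩
    depth D v                  ≡⟨ depth-ancestor j v j≤d ⟨
    depth D (ancestor j v) + j ≡⟨ cong (λ a → depth D a + j) eq ⟨
    depth D (ancestor i v) + j ∎)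

  ancestor-edge : ∀ j v → j < depth D v → EdgeIn E (ancestor j v) (ancestor (suc j) v)
  ancestor-edge j v j<d = parent-edge D (ancestor j v) (ancestor-non-root j v j<d)

record Matching {n} (E : Edges n) (k : ℕ) : Set where
  field
    endpoint           : Fin k → Bool → Fin n
    endpoint-injective : ∀ {i j b c} → endpoint i b ≡ endpoint j c → i ≡ j × b ≡ c
    endpoint-edge      : ∀ i → EdgeIn E (endpoint i false) (endpoint i true)

module _ {n} {E : Edges n} {k} (M : Matching E k) where
  open Matching M

  Matched : Fin n → Fin n → Set
  Matched u v = Σ (Fin k) λ i → Σ Bool λ b → u ≡ endpoint i b × v ≡ endpoint i (not b)

  matched? : ∀ u v → Dec (Matched u v)
  matched? u v = any? λ i → Σ-Bool? λ b → (u ≟ endpoint i b) ×-dec (v ≟ endpoint i (not b))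

  matched-sym : ∀ {u v} → Matched u v → Matched v u
  matched-sym (i , b , refl , refl) =
    i , not b , refl , cong (endpoint i) (sym (not-involutive b))

  matched-unique : ∀ {u w v} → Matched u w → Matched w v → u ≡ v
  matched-unique (i , b , refl , w≡) (j , c , w≡′ , refl)
    with endpoint-injective (trans (sym w≡) w≡′)
  ... | refl , refl = cong (endpoint i) (sym (not-involutive b))

  matched-edge : ∀ {u v} → Matched u v → EdgeIn E u v
  matched-edge (i , false , refl , refl) = endpoint-edge i
  matched-edge (i , true  , refl , refl) = swap (endpoint-edge i)

  unmatchedEdges : Edges n
  unmatchedEdges = filter (¬? ∘ uncurry matched?) E

  ∈-unmatchedEdges⁻ : ∀ {u v} → (u , v) ∈ unmatchedEdges → (u , v) ∈ E × ¬ Matched u v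
  ∈-unmatchedEdges⁻ = ∈-filter⁻ (¬? ∘ uncurry matched?) {xs = E}

  ∈-unmatchedEdges⁺ : ∀ {u v} → (u , v) ∈ E → ¬ Matched u v → (u , v) ∈ unmatchedEdges
  ∈-unmatchedEdges⁺ = ∈-filter⁺ (¬? ∘ uncurry matched?) {xs = E}

  unmatchedEdges⊆E : SubEdges unmatchedEdges E
  unmatchedEdges⊆E u v = Sum.map (proj₁ ∘ ∈-unmatchedEdges⁻) (proj₁ ∘ ∈-unmatchedEdges⁻)

  matched⇒adjacent : ∀ {u v} → Matched u v → AdjMinus E unmatchedEdges u v
  matched⇒adjacent m = matched-edge m ,
    [ (λ e → proj₂ (∈-unmatchedEdges⁻ e) m) , (λ e → proj₂ (∈-unmatchedEdges⁻ e) (matched-sym m)) ]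

  adjacent⇒matched : ∀ {u v} → AdjMinus E unmatchedEdges u v → Matched u v
  adjacent⇒matched {u} {v} (uv∈E , uv∉unmatched) with matched? u v
  ... | yes m = m
  ... | no ¬m = ⊥-elim (uv∉unmatched (Sum.map (λ e → ∈-unmatchedEdges⁺ e ¬m)
                                              (λ e → ∈-unmatchedEdges⁺ e (¬m ∘ matched-sym)) uv∈E))

  connected⇒matched : ∀ {u v} → ConnMinus E unmatchedEdges u v → u ≡ v ⊎ Matched u v
  connected⇒matched ε = inj₁ refl
  connected⇒matched (uw ◅ wv) with adjacent⇒matched uw | connected⇒matched wv
  ... | m | inj₁ refl = inj₂ m
  ... | m | inj₂ m′   = inj₁ (matched-unique m m′)

  unmatchedEdges-colorful : ∀ {C : Set} {c : Fin n → C} →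
                            ProperlyColored c E → AllColorful c E unmatchedEdges
  unmatchedEdges-colorful proper u v uv c≡ with connected⇒matched uv
  ... | inj₁ u≡v = u≡v
  ... | inj₂ m   = ⊥-elim (proper u v (matched-edge m) c≡)

  lowerEndpoint : (i : Fin k) → Σ Bool λ b → toℕ (endpoint i b) < toℕ (endpoint i (not b))
  lowerEndpoint i with <-cmp (toℕ (endpoint i false)) (toℕ (endpoint i true))
  ... | tri< lt _ _ = false , lt
  ... | tri≈ _ eq _ with () ← proj₂ (endpoint-injective (toℕ-injective eq))
  ... | tri> _ _ gt = true , gt

  unmatchedEdges-closure : ClosureAtLeast E unmatchedEdges k
  unmatchedEdges-closure = matchedPair , matchedPair-injective , matchedPair-closureEdge
    where
    matchedPair : Fin k → Fin n × Fin n
    matchedPair i = endpoint i b , endpoint i (not b)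
      where b = proj₁ (lowerEndpoint i)
    matchedPair-injective : ∀ {i j} → matchedPair i ≡ matchedPair j → i ≡ j
    matchedPair-injective eq = proj₁ (endpoint-injective (cong proj₁ eq))
    matchedPair-closureEdge : ∀ i → ClosureEdge E unmatchedEdges (matchedPair i)
    matchedPair-closureEdge i =
      proj₂ (lowerEndpoint i) , matched⇒adjacent (i , proj₁ (lowerEndpoint i) , refl , refl) ◅ ε

pathMatching : ∀ {n} {E : Edges n} (D : RootedSpanningTree E) (v : Fin n) {k} →
               2 * k ≤ depth D v → Matching E k
pathMatching D v {k} 2k≤d = record
  { endpoint           = λ i b → ancestor D (position i b) v
  ; endpoint-injective = λ {i} {j} {b} {c} eq →
      let b≡c , i≡j = bit+*2-injective b c (toℕ i) (toℕ j)
                        (ancestor-injective D (<⇒≤ (position<depth i b)) (<⇒≤ (position<depth j c)) eq)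
      in toℕ-injective i≡j , b≡c
  ; endpoint-edge      = λ i → ancestor-edge D (position i false) v (position<depth i false)
  }
  where
  -- The bit comes first so that position i true reduces to suc (position i false).
  position : Fin k → Bool → ℕ
  position i b = bit b + toℕ i * 2
  position<depth : ∀ i b → position i b < depth D v
  position<depth i b = <-≤-trans (s≤s (+-monoˡ-≤ (toℕ i * 2) (bit≤1 b)))
    (≤-trans (*-monoˡ-≤ 2 (toℕ<n i)) (subst (_≤ depth D v) (*-comm 2 k) 2k≤d))

lemma7 : (n : ℕ) (C : Set) (c : Fin n → C) (E : Edges n) →
         ProperlyColored c E →
         (k : ℕ) → 1 ≤ k →
         (D : RootedSpanningTree E) → IsDFSTree E D →
         (ℓ : Fin n) → Leaf D ℓ → 2 * k ≤ depth D ℓ →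
         Σ (Edges n) λ E' → MECSolution c E E' × ClosureAtLeast E E' k
lemma7 n C c E proper k _ D _ ℓ _ 2k≤d =
  unmatchedEdges M , (unmatchedEdges⊆E M , unmatchedEdges-colorful M proper) ,
  unmatchedEdges-closure M
  where M = pathMatching D ℓ 2k≤d
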